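{- Let $V$ be a finite set and let $S_1,S_2,S_3\subseteq V$ with $|S_i|=k$ for $i=1,2,3$. Write $\bar S_i=V\setminus S_i$. Then $\{V;S_1,S_2,S_3\}$ is invertible if and only if $$|S_1\cap S_2\cap S_3|\leq|\bar S_1\cap\bar S_2\cap\bar S_3|\leq|S_1\cap S_2\cap S_3|+\tfrac{3}{2}(|V|-2k).$$
   Context: A collection $\{V;S_1,\ldots,S_m\}$ of subsets of $V$ is called invertible if there is a permutation $\pi$ of $V$ such that $\pi(S_i)\subseteq V\setminus S_i$ for every $i=1,\ldots,m$. -}

module Defs where

open import Data.Nat using (ℕ)
open import Data.Fin using (Fin)
open import Data.Fin.Subset using (Subset; _∈_; _∉_)
open import Data.Fin.Permutation using (Permutation′; _⟨$⟩ʳ_)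
open import Data.Product using (∃)

-- The ground set V is modelled as Fin n (any finite set is in bijection with one).
Invertible : {n m : ℕ} → (Fin m → Subset n) → Set
Invertible {n} {m} S =
  ∃ λ (π : Permutation′ n) → ∀ (i : Fin m) (x : Fin n) → x ∈ S i → (π ⟨$⟩ʳ x) ∉ S i

{-# OPTIONS --safe #-}
module Submission where

-- Sort the points of V by the region of the Venn diagram of S₁, S₂, S₃ they lie in, and let
-- N r be the number of points in region r. A permutation witnessing invertibility sends every
-- point to a point whose region is disjoint from its own. Hence it maps S₁ ∩ S₂ ∩ S₃ into
-- S̄₁ ∩ S̄₂ ∩ S̄₃, and it maps the points lying in at least two of the sets injectively to points
-- lying in at most one; when |Sᵢ| = k, the second fact is equivalent to the upper bound.
-- Conversely, when both inequalities hold, there is an explicit transport plan between the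
-- regions whose rows and columns sum to N: each region rᵢ exchanges min (N rᵢ) (N rⱼₖ) points
-- with the complementary region rⱼₖ, the surplus of the regions rᵢ cycles r₁ → r₂ → r₃ → r₁,
-- and the surplus of the regions rⱼₖ is exchanged with r∅. Every integral plan between two
-- labellings of V is realised by a permutation: send one point along one unit of the plan,
-- remove that unit, and recurse.

open import Defs
open import Data.Bool using (Bool; true; false; _∧_; _∨_; not; if_then_else_)
import Data.Bool.Properties as Bool
open import Data.Fin using (Fin; zero; suc; punchIn)
open import Data.Fin.Permutation using (Permutation′; _⟨$⟩ʳ_; insert; insert-punchIn)
  renaming (id to idₚ)
open import Data.Fin.Properties using (_≟_)
open import Data.Fin.Subset using (Subset; ∁; _∩_; ∣_∣; _∈_; _∉_)
open import Data.Nat using (ℕ; zero; suc; _≤_; _<_; _+_; _*_; _∸_; _⊓_; z≤n; s≤s)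
open import Data.Nat.Properties
  using (≤-refl; ≤-trans; ≤-reflexive; ≤-total; +-mono-≤; +-monoˡ-≤; +-monoʳ-≤; m≤m+n;
         +-identityʳ; *-identityˡ; *-identityʳ; +-comm; *-comm; ⊓-comm; +-cancelˡ-≡; +-cancelʳ-≡;
         +-cancelˡ-≤; +-cancelʳ-≤; m∸n≤m; m+[n∸m]≡n; m∸n+n≡m; m≤n⇒m∸n≡0; m⊓n+n∸m≡n;
         [m+n]∸[m+o]≡n∸o; +-commutativeSemigroup; +-*-semiring; module ≤-Reasoning)
open import Algebra.Properties.CommutativeSemigroup +-commutativeSemigroup
  using (xy∙z≈xz∙y; x∙yz≈y∙xz)
open import Algebra.Properties.Semiring.Sum +-*-semiring
  using (sum; sum-syntax; sum-cong-≗; sum-replicate-zero; sum-remove; ∑-comm; ∑-distrib-+;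
         ∑-permute; *-distribˡ-sum; *-distribʳ-sum)
open import Data.Nat.Tactic.RingSolver using (solve-∀)
open import Data.Product using (_×_; _,_; ∃; proj₁; proj₂)
open import Data.Sum using (inj₁; inj₂)
open import Data.Vec using (_∷_; []; lookup)
open import Data.Vec.Properties using (lookup-zipWith; lookup-map; []=⇒lookup; lookup⇒[]=)
open import Function using (_∘_)
open import Function.Bundles using (_⇔_; mk⇔; Equivalence)
open import Relation.Binary.PropositionalEquality
open import Relation.Nullary using (Dec; yes; no; does; _×-dec_; contradiction)

∑-mono-≤ : ∀ {n} {f g : Fin n → ℕ} → (∀ i → f i ≤ g i) → sum f ≤ sum g
∑-mono-≤ {zero}  _   = z≤n
∑-mono-≤ {suc n} f≤g = +-mono-≤ (f≤g zero) (∑-mono-≤ (f≤g ∘ suc))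

∑-≤-along : ∀ {n} {f g : Fin n → ℕ} (π : Permutation′ n) → (∀ i → f i ≤ g (π ⟨$⟩ʳ i)) →
            sum f ≤ sum g
∑-≤-along {g = g} π f≤g∘π = ≤-trans (∑-mono-≤ f≤g∘π) (≤-reflexive (sym (∑-permute g π)))

∃-positive-term : ∀ {n} (f : Fin n → ℕ) → 0 < sum f → ∃ λ i → 0 < f i
∃-positive-term {suc n} f 0<∑f with f zero in f₀≡
... | suc _ = zero , subst (0 <_) (sym f₀≡) (s≤s z≤n)
... | zero  = let i , 0<fi = ∃-positive-term (f ∘ suc) 0<∑f in suc i , 0<fi

term≤∑ : ∀ {n} (f : Fin n → ℕ) i → f i ≤ sum f
term≤∑ {suc n} f i = ≤-trans (m≤m+n (f i) _) (≤-reflexive (sym (sum-remove {i = i} f)))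

∑1≡n : ∀ n → ∑[ i < n ] 1 ≡ n
∑1≡n zero    = refl
∑1≡n (suc n) = cong suc (∑1≡n n)

_if?_ : ∀ {p} {P : Set p} → ℕ → Dec P → ℕ
a if? P? = if does P? then a else 0

if?-positive : ∀ {p} {P : Set p} {a} (P? : Dec P) → 0 < a if? P? → P
if?-positive (yes p) _ = p

if?-yes : ∀ {p} {P : Set p} {a} (P? : Dec P) → P → a if? P? ≡ a
if?-yes (yes _) _ = refl
if?-yes (no ¬p) p = contradiction p ¬p

δ : ∀ {m} → Fin m → Fin m → ℕ
δ s t = 1 if? (s ≟ t)

∑-select : ∀ {m} (s : Fin m) (g : Fin m → ℕ) → ∑[ t < m ] (δ s t * g t) ≡ g s
∑-select {suc m} zero    g =
  trans (cong₂ _+_ (*-identityˡ (g zero)) (sum-replicate-zero m)) (+-identityʳ (g zero))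
∑-select {suc m} (suc s) g = ∑-select s (g ∘ suc)

∑-δ : ∀ {m} (s : Fin m) → ∑[ t < m ] δ s t ≡ 1
∑-δ s = trans (sum-cong-≗ (λ t → sym (*-identityʳ (δ s t)))) (∑-select s (λ _ → 1))

fibre : ∀ {n m} → (Fin n → Fin m) → Fin m → ℕ
fibre {n} τ t = ∑[ x < n ] δ (τ x) t

0<fibre-image : ∀ {n m} (τ : Fin n → Fin m) x → 0 < fibre τ (τ x)
0<fibre-image τ x =
  ≤-trans (≤-reflexive (sym (if?-yes (τ x ≟ τ x) refl))) (term≤∑ (λ y → δ (τ y) (τ x)) x)

0<fibre⇒∃preimage : ∀ {n m} (τ : Fin n → Fin m) t → 0 < fibre τ t → ∃ λ x → τ x ≡ t
0<fibre⇒∃preimage τ t 0<fibre =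
  let x , 0<δ = ∃-positive-term (λ x → δ (τ x) t) 0<fibre in x , if?-positive (τ x ≟ t) 0<δ

fibre-remove : ∀ {n m} (τ : Fin (suc n) → Fin m) x t →
               fibre τ t ≡ δ (τ x) t + fibre (τ ∘ punchIn x) t
fibre-remove τ x t = sum-remove {i = x} (λ y → δ (τ y) t)

∑-by-fibres : ∀ {n m} (τ : Fin n → Fin m) (g : Fin m → ℕ) →
              ∑[ x < n ] g (τ x) ≡ ∑[ t < m ] (g t * fibre τ t)
∑-by-fibres {n} {m} τ g = begin
  ∑[ x < n ] g (τ x)                       ≡⟨ sum-cong-≗ (λ x → ∑-select (τ x) g) ⟨
  ∑[ x < n ] ∑[ t < m ] (δ (τ x) t * g t)  ≡⟨ ∑-comm (λ x t → δ (τ x) t * g t) ⟩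
  ∑[ t < m ] ∑[ x < n ] (δ (τ x) t * g t)  ≡⟨ sum-cong-≗ (λ t → *-distribʳ-sum (g t) (λ x → δ (τ x) t)) ⟨
  ∑[ t < m ] (fibre τ t * g t)             ≡⟨ sum-cong-≗ (λ t → *-comm (fibre τ t) (g t)) ⟩
  ∑[ t < m ] (g t * fibre τ t)             ∎
  where open ≡-Reasoning

-- Realising a transport plan by a permutation

Plan : ℕ → Set
Plan m = Fin m → Fin m → ℕ

outflow inflow : ∀ {m} → Plan m → Fin m → ℕ
outflow {m} f t = ∑[ u < m ] f t u
inflow  {m} f u = ∑[ t < m ] f t u

unit : ∀ {m} → Fin m → Fin m → Plan m
unit t u t′ u′ = δ t t′ * δ u u′

outflow-unit : ∀ {m} (t u t′ : Fin m) → outflow (unit t u) t′ ≡ δ t t′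
outflow-unit t u t′ = begin
  outflow (unit t u) t′  ≡⟨ *-distribˡ-sum (δ t t′) (δ u) ⟨
  δ t t′ * sum (δ u)     ≡⟨ cong (δ t t′ *_) (∑-δ u) ⟩
  δ t t′ * 1             ≡⟨ *-identityʳ (δ t t′) ⟩
  δ t t′                 ∎
  where open ≡-Reasoning

inflow-unit : ∀ {m} (t u u′ : Fin m) → inflow (unit t u) u′ ≡ δ u u′
inflow-unit t u u′ = begin
  inflow (unit t u) u′  ≡⟨ *-distribʳ-sum (δ u u′) (δ t) ⟨
  sum (δ t) * δ u u′    ≡⟨ cong (_* δ u u′) (∑-δ t) ⟩
  1 * δ u u′            ≡⟨ *-identityˡ (δ u u′) ⟩
  δ u u′                ∎
  where open ≡-Reasoning

unit≤plan : ∀ {m} (f : Plan m) {t u} → 0 < f t u → ∀ t′ u′ → unit t u t′ u′ ≤ f t′ u′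
unit≤plan f {t} {u} 0<ftu t′ u′ = by-cases (t ≟ t′) (u ≟ u′)
  where
  by-cases : (t≟t′ : Dec (t ≡ t′)) (u≟u′ : Dec (u ≡ u′)) → (1 if? t≟t′) * (1 if? u≟u′) ≤ f t′ u′
  by-cases (yes refl) (yes refl) = 0<ftu
  by-cases (yes _)    (no _)     = z≤n
  by-cases (no _)     _          = z≤n

removeUnit : ∀ {m} → Plan m → Fin m → Fin m → Plan m
removeUnit f t u t′ u′ = f t′ u′ ∸ unit t u t′ u′

removeUnit≤ : ∀ {m} (f : Plan m) t u t′ u′ → removeUnit f t u t′ u′ ≤ f t′ u′
removeUnit≤ f t u t′ u′ = m∸n≤m (f t′ u′) (unit t u t′ u′)

module _ {m} (f : Plan m) {t u : Fin m} (0<ftu : 0 < f t u) where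

  private
    f≡unit+removeUnit : ∀ t′ u′ → f t′ u′ ≡ unit t u t′ u′ + removeUnit f t u t′ u′
    f≡unit+removeUnit t′ u′ = sym (m+[n∸m]≡n (unit≤plan f 0<ftu t′ u′))

  outflow-removeUnit : ∀ t′ → outflow f t′ ≡ δ t t′ + outflow (removeUnit f t u) t′
  outflow-removeUnit t′ = begin
    outflow f t′                               ≡⟨ sum-cong-≗ (f≡unit+removeUnit t′) ⟩
    ∑[ u′ < m ] (unit t u t′ u′ + f⁻ t′ u′)     ≡⟨ ∑-distrib-+ (unit t u t′) (f⁻ t′) ⟩
    outflow (unit t u) t′ + outflow f⁻ t′       ≡⟨ cong (_+ outflow f⁻ t′) (outflow-unit t u t′) ⟩
    δ t t′ + outflow f⁻ t′                      ∎
    where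
    open ≡-Reasoning
    f⁻ : Plan m
    f⁻ = removeUnit f t u

  inflow-removeUnit : ∀ u′ → inflow f u′ ≡ δ u u′ + inflow (removeUnit f t u) u′
  inflow-removeUnit u′ = begin
    inflow f u′                                ≡⟨ sum-cong-≗ (λ t′ → f≡unit+removeUnit t′ u′) ⟩
    ∑[ t′ < m ] (unit t u t′ u′ + f⁻ t′ u′)     ≡⟨ ∑-distrib-+ (λ t′ → unit t u t′ u′) (λ t′ → f⁻ t′ u′) ⟩
    inflow (unit t u) u′ + inflow f⁻ u′         ≡⟨ cong (_+ inflow f⁻ u′) (inflow-unit t u u′) ⟩
    δ u u′ + inflow f⁻ u′                       ∎
    where
    open ≡-Reasoning
    f⁻ : Plan m
    f⁻ = removeUnit f t u

plan⇒permutation : ∀ {m} {R : Fin m → Fin m → Set} n (τ σ : Fin n → Fin m) (f : Plan m) →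
  (∀ t u → 0 < f t u → R t u) →
  (∀ t → outflow f t ≡ fibre τ t) →
  (∀ u → inflow f u ≡ fibre σ u) →
  ∃ λ (π : Permutation′ n) → ∀ x → R (τ x) (σ (π ⟨$⟩ʳ x))
plan⇒permutation zero τ σ f _ _ _ = idₚ , λ ()
plan⇒permutation {R = R} (suc n) τ σ f supported outflow≡ inflow≡
  with u , 0<f₀u ← ∃-positive-term (f (τ zero))
                     (subst (0 <_) (sym (outflow≡ (τ zero))) (0<fibre-image τ zero))
  with y , refl  ← 0<fibre⇒∃preimage σ u
                     (subst (0 <_) (inflow≡ u) (≤-trans 0<f₀u (term≤∑ (λ t → f t u) (τ zero))))
  with π , realised ← plan⇒permutation n (τ ∘ suc) (σ ∘ punchIn y) (removeUnit f (τ zero) (σ y))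
         (λ t′ u′ 0<f⁻ → supported t′ u′ (≤-trans 0<f⁻ (removeUnit≤ f (τ zero) (σ y) t′ u′)))
         (λ t′ → +-cancelˡ-≡ (δ (τ zero) t′) _ _
                   (trans (sym (outflow-removeUnit f 0<f₀u t′)) (outflow≡ t′)))
         (λ u′ → +-cancelˡ-≡ (δ (σ y) u′) _ _
                   (trans (sym (inflow-removeUnit f 0<f₀u u′)) (trans (inflow≡ u′) (fibre-remove σ y u′))))
  = insert zero y π , λ where
      zero    → supported (τ zero) (σ y) 0<f₀u
      (suc x) → subst (R (τ (suc x)) ∘ σ) (sym (insert-punchIn zero y π x)) (realised x)

bit : Bool → ℕ
bit false = 0
bit true  = 1

∣p∣≡∑ : ∀ {n} (p : Subset n) → ∣ p ∣ ≡ ∑[ x < n ] bit (lookup p x)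
∣p∣≡∑ []          = refl
∣p∣≡∑ (true  ∷ p) = cong suc (∣p∣≡∑ p)
∣p∣≡∑ (false ∷ p) = ∣p∣≡∑ p

avoids⇔∧≡false : ∀ {n} (p : Subset n) x y → (x ∈ p → y ∉ p) ⇔ lookup p x ∧ lookup p y ≡ false
avoids⇔∧≡false p x y = mk⇔ to from
  where
  to : (x ∈ p → y ∉ p) → lookup p x ∧ lookup p y ≡ false
  to avoids with lookup p x in px | lookup p y in py
  ... | false | _     = refl
  ... | true  | false = refl
  ... | true  | true  = contradiction (lookup⇒[]= y p py) (avoids (lookup⇒[]= x p px))
  from : lookup p x ∧ lookup p y ≡ false → x ∈ p → y ∉ p
  from px∧py≡false x∈p y∈p
    with () ← trans (sym (cong₂ _∧_ ([]=⇒lookup x∈p) ([]=⇒lookup y∈p))) px∧py≡false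

-- The regions of the Venn diagram of three sets

Region : Set
Region = Bool × Bool × Bool

-- rᵢⱼ indexes the region of the points lying in Sᵢ and Sⱼ only; region (a₁ , a₂ , a₃) has index
-- 4 a₁ + 2 a₂ + a₃.
pattern r∅   = zero
pattern r₃   = suc zero
pattern r₂   = suc (suc zero)
pattern r₂₃  = suc (suc (suc zero))
pattern r₁   = suc (suc (suc (suc zero)))
pattern r₁₃  = suc (suc (suc (suc (suc zero))))
pattern r₁₂  = suc (suc (suc (suc (suc (suc zero)))))
pattern r₁₂₃ = suc (suc (suc (suc (suc (suc (suc zero))))))

region : Fin 8 → Region
region r∅   = false , false , false
region r₃   = false , false , true
region r₂   = false , true  , false
region r₂₃  = false , true  , true
region r₁   = true  , false , false
region r₁₃  = true  , false , true
region r₁₂  = true  , true  , false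
region r₁₂₃ = true  , true  , true

index : Region → Fin 8
index (false , false , false) = r∅
index (false , false , true)  = r₃
index (false , true  , false) = r₂
index (false , true  , true)  = r₂₃
index (true  , false , false) = r₁
index (true  , false , true)  = r₁₃
index (true  , true  , false) = r₁₂
index (true  , true  , true)  = r₁₂₃

region-index : ∀ r → region (index r) ≡ r
region-index (false , false , false) = refl
region-index (false , false , true)  = refl
region-index (false , true  , false) = refl
region-index (false , true  , true)  = refl
region-index (true  , false , false) = refl
region-index (true  , false , true)  = refl
region-index (true  , true  , false) = refl
region-index (true  , true  , true)  = refl

Disjoint : Region → Region → Set
Disjoint (a₁ , a₂ , a₃) (b₁ , b₂ , b₃) = a₁ ∧ b₁ ≡ false × a₂ ∧ b₂ ≡ false × a₃ ∧ b₃ ≡ false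

disjoint? : ∀ r s → Dec (Disjoint r s)
disjoint? (a₁ , a₂ , a₃) (b₁ , b₂ , b₃) =
  a₁ ∧ b₁ Bool.≟ false ×-dec a₂ ∧ b₂ Bool.≟ false ×-dec a₃ ∧ b₃ Bool.≟ false

full empty heavy light : Region → Bool
full  (a₁ , a₂ , a₃) = a₁ ∧ a₂ ∧ a₃
empty (a₁ , a₂ , a₃) = not a₁ ∧ not a₂ ∧ not a₃
heavy (a₁ , a₂ , a₃) = a₁ ∧ a₂ ∨ a₁ ∧ a₃ ∨ a₂ ∧ a₃
light r = not (heavy r)

full⇒empty : ∀ r s → Disjoint r s → bit (full r) ≤ bit (empty s)
full⇒empty (false , _     , _)     _           _                    = z≤n
full⇒empty (true  , false , _)     _           _                    = z≤n
full⇒empty (true  , true  , false) _           _                    = z≤n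
full⇒empty (true  , true  , true)  (_ , _ , _) (refl , refl , refl) = ≤-refl

heavy⇒light : ∀ r s → Disjoint r s → bit (heavy r) ≤ bit (light s)
heavy⇒light (false , false , _)     _               _                 = z≤n
heavy⇒light (false , true  , false) _               _                 = z≤n
heavy⇒light (true  , false , false) _               _                 = z≤n
heavy⇒light (false , true  , true)  (false , _ , _) (_ , refl , refl) = ≤-refl
heavy⇒light (false , true  , true)  (true  , _ , _) (_ , refl , refl) = ≤-refl
heavy⇒light (true  , false , true)  (_ , false , _) (refl , _ , refl) = ≤-refl
heavy⇒light (true  , false , true)  (_ , true  , _) (refl , _ , refl) = ≤-refl
heavy⇒light (true  , true  , _)     (_ , _ , _)     (refl , refl , _) = ≤-refl

record Schedule : Set where
  field
    paired₁ paired₂ paired₃ cycled spread swapped fixed : ℕ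

open Schedule

move : Schedule → Fin 8 → Fin 8 → ℕ
move σ r∅   r∅   = fixed σ
move σ r∅   r₁₂₃ = swapped σ
move σ r₁₂₃ r∅   = swapped σ
move σ r∅   r₂₃  = spread σ
move σ r₂₃  r∅   = spread σ
move σ r∅   r₁₃  = spread σ
move σ r₁₃  r∅   = spread σ
move σ r∅   r₁₂  = spread σ
move σ r₁₂  r∅   = spread σ
move σ r₁   r₂₃  = paired₁ σ
move σ r₂₃  r₁   = paired₁ σ
move σ r₂   r₁₃  = paired₂ σ
move σ r₁₃  r₂   = paired₂ σ
move σ r₃   r₁₂  = paired₃ σ
move σ r₁₂  r₃   = paired₃ σ
move σ r₁   r₂   = cycled σ
move σ r₂   r₃   = cycled σ
move σ r₃   r₁   = cycled σ
move σ _    _    = 0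

-- move is already zero between regions that are not disjoint; restricting it anyway makes the
-- support condition of plan⇒permutation hold by construction.
plan : Schedule → Plan 8
plan σ t u = move σ t u if? disjoint? (region t) (region u)

plan-disjoint : ∀ σ t u → 0 < plan σ t u → Disjoint (region t) (region u)
plan-disjoint σ t u = if?-positive (disjoint? (region t) (region u))

inflow≡outflow : ∀ σ u → inflow (plan σ) u ≡ outflow (plan σ) u
inflow≡outflow σ r∅   = refl
inflow≡outflow σ r₃   = refl
inflow≡outflow σ r₂   = refl
inflow≡outflow σ r₂₃  = refl
inflow≡outflow σ r₁   = refl
inflow≡outflow σ r₁₃  = refl
inflow≡outflow σ r₁₂  = refl
inflow≡outflow σ r₁₂₃ = refl

∸-exchange : ∀ a b c d → a + b ≡ c + d → a ∸ d ≡ c ∸ b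
∸-exchange a b c d a+b≡c+d = begin
  a ∸ d              ≡⟨ [m+n]∸[m+o]≡n∸o b a d ⟨
  (b + a) ∸ (b + d)  ≡⟨ cong₂ _∸_ (trans (+-comm b a) a+b≡c+d) (+-comm b d) ⟩
  (c + d) ∸ (d + b)  ≡⟨ cong (_∸ (d + b)) (+-comm c d) ⟩
  (d + c) ∸ (d + b)  ≡⟨ [m+n]∸[m+o]≡n∸o d c b ⟩
  c ∸ b              ∎
  where open ≡-Reasoning

∸-exchange′ : ∀ a b c d → a + b ≡ c + d → d ∸ a ≡ b ∸ c
∸-exchange′ a b c d a+b≡c+d =
  ∸-exchange d c b a (trans (+-comm d c) (trans (sym a+b≡c+d) (+-comm a b)))

+-exchange : ∀ {a a′ b b′ e} → a + b′ ≡ a′ + b → a + e ≡ b → a′ + e ≡ b′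
+-exchange {a} {a′} {b} {b′} {e} a+b′≡a′+b a+e≡b = sym (+-cancelˡ-≡ a _ _ (begin
  a + b′        ≡⟨ a+b′≡a′+b ⟩
  a′ + b        ≡⟨ cong (a′ +_) a+e≡b ⟨
  a′ + (a + e)  ≡⟨ x∙yz≈y∙xz a′ a e ⟩
  a + (a′ + e)  ∎))
  where open ≡-Reasoning

-- The trailing + 0 is how an outflow of plan unfolds.
∸+⊓ : ∀ m n → n ∸ m + (m ⊓ n + 0) ≡ n
∸+⊓ m n = trans (cong (n ∸ m +_) (+-identityʳ (m ⊓ n)))
                (trans (+-comm (n ∸ m) (m ⊓ n)) (m⊓n+n∸m≡n m n))

∸+⊓′ : ∀ m n → n ∸ m + (n ⊓ m + 0) ≡ n
∸+⊓′ m n = trans (cong (λ x → n ∸ m + (x + 0)) (⊓-comm n m)) (∸+⊓ m n)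

module Census (N : Fin 8 → ℕ) where

  #S₁ #S₂ #S₃ #V #heavy #light : ℕ
  #S₁    = N r₁ + N r₁₃ + N r₁₂ + N r₁₂₃
  #S₂    = N r₂ + N r₂₃ + N r₁₂ + N r₁₂₃
  #S₃    = N r₃ + N r₂₃ + N r₁₃ + N r₁₂₃
  #V     = N r∅ + N r₃ + N r₂ + N r₂₃ + N r₁ + N r₁₃ + N r₁₂ + N r₁₂₃
  #heavy = N r₂₃ + N r₁₃ + N r₁₂ + N r₁₂₃
  #light = N r∅ + N r₃ + N r₂ + N r₁

  excess : ℕ
  excess = N r₂₃ ∸ N r₁

  leaving-r∅ : ℕ
  leaving-r∅ = excess + (excess + (excess + N r₁₂₃))

  -- Equal sizes make N rᵢ ∸ N rⱼₖ independent of i, and likewise N rⱼₖ ∸ N rᵢ (the excess); at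
  -- least one of the two is zero.
  scheduleFor : Schedule
  scheduleFor = record
    { paired₁ = N r₁ ⊓ N r₂₃
    ; paired₂ = N r₂ ⊓ N r₁₃
    ; paired₃ = N r₃ ⊓ N r₁₂
    ; cycled  = N r₁ ∸ N r₂₃
    ; spread  = excess
    ; swapped = N r₁₂₃
    ; fixed   = N r∅ ∸ leaving-r∅
    }

  module _ {k} (#S₁≡k : #S₁ ≡ k) (#S₂≡k : #S₂ ≡ k) (#S₃≡k : #S₃ ≡ k) where

    r₁+r₁₃≡r₂+r₂₃ : N r₁ + N r₁₃ ≡ N r₂ + N r₂₃
    r₁+r₁₃≡r₂+r₂₃ = +-cancelʳ-≡ (N r₁₂) _ _ (+-cancelʳ-≡ (N r₁₂₃) _ _ (trans #S₁≡k (sym #S₂≡k)))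

    r₁+r₁₂≡r₃+r₂₃ : N r₁ + N r₁₂ ≡ N r₃ + N r₂₃
    r₁+r₁₂≡r₃+r₂₃ = +-cancelʳ-≡ (N r₁₃) _ _ (trans (xy∙z≈xz∙y (N r₁) (N r₁₂) (N r₁₃))
                      (+-cancelʳ-≡ (N r₁₂₃) _ _ (trans #S₁≡k (sym #S₃≡k))))

    budget⇔#heavy≤#light : ∀ {n z w} → z ≡ N r∅ → w ≡ N r₁₂₃ → n ≡ #V →
                           2 * z + 6 * k ≤ 2 * w + 3 * n ⇔ #heavy ≤ #light
    budget⇔#heavy≤#light {n} refl refl refl = mk⇔
      (λ budget → +-cancelˡ-≤ (2 * N r₁₂₃ + 3 * n) _ _ (begin
         2 * N r₁₂₃ + 3 * n + #heavy  ≡⟨ identity ⟨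
         2 * N r∅ + 6 * k + #light    ≤⟨ +-monoˡ-≤ #light budget ⟩
         2 * N r₁₂₃ + 3 * n + #light  ∎))
      (λ #heavy≤#light → +-cancelʳ-≤ #light _ _ (begin
         2 * N r∅ + 6 * k + #light    ≡⟨ identity ⟩
         2 * N r₁₂₃ + 3 * n + #heavy  ≤⟨ +-monoʳ-≤ (2 * N r₁₂₃ + 3 * n) #heavy≤#light ⟩
         2 * N r₁₂₃ + 3 * n + #light  ∎))
      where
      open ≤-Reasoning
      6k≡ : ∀ {a b c} → a ≡ k → b ≡ k → c ≡ k → 6 * k ≡ 2 * a + 2 * b + 2 * c
      6k≡ refl refl refl = lemma k
        where
        lemma : ∀ k → 6 * k ≡ 2 * k + 2 * k + 2 * k
        lemma = solve-∀
      -- Per point lying in j of the sets: 2 [j = 0] + 2 j + [j ≤ 1] = 2 [j = 3] + 3 + [j ≥ 2].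
      identity : 2 * N r∅ + 6 * k + #light ≡ 2 * N r₁₂₃ + 3 * n + #heavy
      identity = trans (cong (λ m → 2 * N r∅ + m + #light) (6k≡ #S₁≡k #S₂≡k #S₃≡k))
                       (lemma (N r∅) (N r₁) (N r₂) (N r₃) (N r₁₂) (N r₁₃) (N r₂₃) (N r₁₂₃))
        where
        lemma : ∀ c∅ c₁ c₂ c₃ c₁₂ c₁₃ c₂₃ c₁₂₃ →
          2 * c∅ + (2 * (c₁ + c₁₃ + c₁₂ + c₁₂₃) + 2 * (c₂ + c₂₃ + c₁₂ + c₁₂₃)
                    + 2 * (c₃ + c₂₃ + c₁₃ + c₁₂₃)) + (c∅ + c₃ + c₂ + c₁)
          ≡ 2 * c₁₂₃ + 3 * (c∅ + c₃ + c₂ + c₂₃ + c₁ + c₁₃ + c₁₂ + c₁₂₃) + (c₂₃ + c₁₃ + c₁₂ + c₁₂₃)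
        lemma = solve-∀

    module _ (r₁₂₃≤r∅ : N r₁₂₃ ≤ N r∅) (#heavy≤#light : #heavy ≤ #light) where

      leaving-r∅≤r∅ : leaving-r∅ ≤ N r∅
      leaving-r∅≤r∅ with ≤-total (N r₂₃) (N r₁)
      ... | inj₁ r₂₃≤r₁ = subst (λ e → e + (e + (e + N r₁₂₃)) ≤ N r∅) (sym (m≤n⇒m∸n≡0 r₂₃≤r₁)) r₁₂₃≤r∅
      ... | inj₂ r₁≤r₂₃ = +-cancelʳ-≤ (N r₁ + N r₂ + N r₃) _ _ (begin
          leaving-r∅ + (N r₁ + N r₂ + N r₃)                           ≡⟨ regroup (N r₁) (N r₂) (N r₃) excess (N r₁₂₃) ⟩
          N r₁ + excess + (N r₂ + excess) + (N r₃ + excess) + N r₁₂₃  ≡⟨ cong₃ r₂₃≡ r₁₃≡ r₁₂≡ ⟩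
          #heavy                                                      ≤⟨ #heavy≤#light ⟩
          #light                                                      ≡⟨ regroup′ (N r∅) (N r₁) (N r₂) (N r₃) ⟩
          N r∅ + (N r₁ + N r₂ + N r₃)                                 ∎)
        where
        open ≤-Reasoning
        r₂₃≡ : N r₁ + excess ≡ N r₂₃
        r₂₃≡ = m+[n∸m]≡n r₁≤r₂₃
        r₁₃≡ : N r₂ + excess ≡ N r₁₃
        r₁₃≡ = +-exchange r₁+r₁₃≡r₂+r₂₃ r₂₃≡
        r₁₂≡ : N r₃ + excess ≡ N r₁₂
        r₁₂≡ = +-exchange r₁+r₁₂≡r₃+r₂₃ r₂₃≡
        cong₃ : ∀ {x x′ y y′ z z′} → x ≡ x′ → y ≡ y′ → z ≡ z′ →
                x + y + z + N r₁₂₃ ≡ x′ + y′ + z′ + N r₁₂₃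
        cong₃ refl refl refl = refl
        regroup : ∀ a₁ a₂ a₃ e w → e + (e + (e + w)) + (a₁ + a₂ + a₃) ≡ a₁ + e + (a₂ + e) + (a₃ + e) + w
        regroup = solve-∀
        regroup′ : ∀ z a₁ a₂ a₃ → z + a₃ + a₂ + a₁ ≡ z + (a₁ + a₂ + a₃)
        regroup′ = solve-∀

      outflow-scheduleFor : ∀ t → outflow (plan scheduleFor) t ≡ N t
      outflow-scheduleFor r∅   =
        trans (cong (λ x → N r∅ ∸ leaving-r∅ + (excess + (excess + (excess + x)))) (+-identityʳ (N r₁₂₃)))
              (m∸n+n≡m leaving-r∅≤r∅)
      outflow-scheduleFor r₃   = trans (cong (_+ (N r₃ ⊓ N r₁₂ + 0))
                                   (∸-exchange (N r₁) (N r₁₂) (N r₃) (N r₂₃) r₁+r₁₂≡r₃+r₂₃))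
                                   (∸+⊓′ (N r₁₂) (N r₃))
      outflow-scheduleFor r₂   = trans (cong (_+ (N r₂ ⊓ N r₁₃ + 0))
                                   (∸-exchange (N r₁) (N r₁₃) (N r₂) (N r₂₃) r₁+r₁₃≡r₂+r₂₃))
                                   (∸+⊓′ (N r₁₃) (N r₂))
      outflow-scheduleFor r₂₃  = ∸+⊓ (N r₁) (N r₂₃)
      outflow-scheduleFor r₁   = ∸+⊓′ (N r₂₃) (N r₁)
      outflow-scheduleFor r₁₃  = trans (cong (_+ (N r₂ ⊓ N r₁₃ + 0))
                                   (∸-exchange′ (N r₁) (N r₁₃) (N r₂) (N r₂₃) r₁+r₁₃≡r₂+r₂₃))
                                   (∸+⊓ (N r₂) (N r₁₃))
      outflow-scheduleFor r₁₂  = trans (cong (_+ (N r₃ ⊓ N r₁₂ + 0))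
                                   (∸-exchange′ (N r₁) (N r₁₂) (N r₃) (N r₂₃) r₁+r₁₂≡r₃+r₂₃))
                                   (∸+⊓ (N r₃) (N r₁₂))
      outflow-scheduleFor r₁₂₃ = +-identityʳ (N r₁₂₃)

-- Counting the points of three subsets by region

private
  -- Sums over regions unfold to right-nested sums ending in + 0.
  tidy₄ : ∀ a b c d → a + (b + (c + (d + 0))) ≡ a + b + c + d
  tidy₄ = solve-∀
  tidy₈ : ∀ a b c d e f g h →
          a + (b + (c + (d + (e + (f + (g + (h + 0))))))) ≡ a + b + c + d + e + f + g + h
  tidy₈ = solve-∀

module Venn {n : ℕ} (S₁ S₂ S₃ : Subset n) where

  regionOf : Fin n → Region
  regionOf x = lookup S₁ x , lookup S₂ x , lookup S₃ x

  census : Fin 8 → ℕ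
  census = fibre (index ∘ regionOf)

  open Census census

  count : (Region → Bool) → ℕ
  count Q = ∑[ t < 8 ] (if Q (region t) then census t else 0)

  ∑-by-regions : ∀ Q → ∑[ x < n ] bit (Q (regionOf x)) ≡ count Q
  ∑-by-regions Q = begin
    ∑[ x < n ] bit (Q (regionOf x))                   ≡⟨ sum-cong-≗ (cong (bit ∘ Q) ∘ region-index ∘ regionOf) ⟨
    ∑[ x < n ] bit (Q (region (index (regionOf x))))  ≡⟨ ∑-by-fibres (index ∘ regionOf) (bit ∘ Q ∘ region) ⟩
    ∑[ t < 8 ] (bit (Q (region t)) * census t)        ≡⟨ sum-cong-≗ (λ t → bit* (Q (region t)) (census t)) ⟩
    count Q                                           ∎
    where
    open ≡-Reasoning
    bit* : ∀ b m → bit b * m ≡ (if b then m else 0)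
    bit* false m = refl
    bit* true  m = +-identityʳ m

  ∣∣-by-regions : ∀ (p : Subset n) Q → (∀ x → lookup p x ≡ Q (regionOf x)) → ∣ p ∣ ≡ count Q
  ∣∣-by-regions p Q p≗Q = trans (∣p∣≡∑ p) (trans (sum-cong-≗ (cong bit ∘ p≗Q)) (∑-by-regions Q))

  ∣S₁∣≡ : ∣ S₁ ∣ ≡ #S₁
  ∣S₁∣≡ = trans (∣∣-by-regions S₁ (λ (a₁ , _ , _) → a₁) (λ _ → refl))
                (tidy₄ (census r₁) (census r₁₃) (census r₁₂) (census r₁₂₃))

  ∣S₂∣≡ : ∣ S₂ ∣ ≡ #S₂
  ∣S₂∣≡ = trans (∣∣-by-regions S₂ (λ (_ , a₂ , _) → a₂) (λ _ → refl))
                (tidy₄ (census r₂) (census r₂₃) (census r₁₂) (census r₁₂₃))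

  ∣S₃∣≡ : ∣ S₃ ∣ ≡ #S₃
  ∣S₃∣≡ = trans (∣∣-by-regions S₃ (λ (_ , _ , a₃) → a₃) (λ _ → refl))
                (tidy₄ (census r₃) (census r₂₃) (census r₁₃) (census r₁₂₃))

  n≡#V : n ≡ #V
  n≡#V = trans (sym (∑1≡n n)) (trans (∑-by-regions (λ _ → true))
           (tidy₈ (census r∅) (census r₃) (census r₂) (census r₂₃)
                  (census r₁) (census r₁₃) (census r₁₂) (census r₁₂₃)))

  ∣S₁∩S₂∩S₃∣≡ : ∣ S₁ ∩ S₂ ∩ S₃ ∣ ≡ census r₁₂₃
  ∣S₁∩S₂∩S₃∣≡ = trans (∣∣-by-regions (S₁ ∩ S₂ ∩ S₃) full λ x →
    trans (lookup-zipWith _∧_ x S₁ (S₂ ∩ S₃)) (cong (lookup S₁ x ∧_) (lookup-zipWith _∧_ x S₂ S₃)))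
    (+-identityʳ (census r₁₂₃))

  ∣∁S₁∩∁S₂∩∁S₃∣≡ : ∣ ∁ S₁ ∩ ∁ S₂ ∩ ∁ S₃ ∣ ≡ census r∅
  ∣∁S₁∩∁S₂∩∁S₃∣≡ = trans (∣∣-by-regions (∁ S₁ ∩ ∁ S₂ ∩ ∁ S₃) empty λ x →
    trans (lookup-zipWith _∧_ x (∁ S₁) (∁ S₂ ∩ ∁ S₃))
          (cong₂ _∧_ (lookup-map x not S₁)
                     (trans (lookup-zipWith _∧_ x (∁ S₂) (∁ S₃))
                            (cong₂ _∧_ (lookup-map x not S₂) (lookup-map x not S₃)))))
    (+-identityʳ (census r∅))

  invertible⇔ : Invertible (lookup (S₁ ∷ S₂ ∷ S₃ ∷ [])) ⇔
                ∃ λ (π : Permutation′ n) → ∀ x → Disjoint (regionOf x) (regionOf (π ⟨$⟩ʳ x))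
  invertible⇔ = mk⇔
    (λ (π , avoids) → π , λ x → let y = π ⟨$⟩ʳ x in
       to (avoids⇔∧≡false S₁ x y) (avoids zero x) ,
       to (avoids⇔∧≡false S₂ x y) (avoids (suc zero) x) ,
       to (avoids⇔∧≡false S₃ x y) (avoids (suc (suc zero)) x))
    (λ (π , disjoint) → π , λ where
       zero             x → from (avoids⇔∧≡false S₁ x (π ⟨$⟩ʳ x)) (proj₁ (disjoint x))
       (suc zero)       x → from (avoids⇔∧≡false S₂ x (π ⟨$⟩ʳ x)) (proj₁ (proj₂ (disjoint x)))
       (suc (suc zero)) x → from (avoids⇔∧≡false S₃ x (π ⟨$⟩ʳ x)) (proj₂ (proj₂ (disjoint x))))
    where open Equivalence

  count-≤-along : ∀ {Q Q′} (π : Permutation′ n) →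
    (∀ x → bit (Q (regionOf x)) ≤ bit (Q′ (regionOf (π ⟨$⟩ʳ x)))) → count Q ≤ count Q′
  count-≤-along {Q} {Q′} π Q≤Q′∘π = subst₂ _≤_ (∑-by-regions Q) (∑-by-regions Q′) (∑-≤-along π Q≤Q′∘π)

  module _ (π : Permutation′ n) (disjoint : ∀ x → Disjoint (regionOf x) (regionOf (π ⟨$⟩ʳ x))) where

    r₁₂₃≤r∅ : census r₁₂₃ ≤ census r∅
    r₁₂₃≤r∅ = subst₂ _≤_ (+-identityʳ (census r₁₂₃)) (+-identityʳ (census r∅))
      (count-≤-along {full} {empty} π λ x → full⇒empty (regionOf x) (regionOf (π ⟨$⟩ʳ x)) (disjoint x))

    #heavy≤#light : #heavy ≤ #light
    #heavy≤#light = subst₂ _≤_ (tidy₄ (census r₂₃) (census r₁₃) (census r₁₂) (census r₁₂₃))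
                               (tidy₄ (census r∅) (census r₃) (census r₂) (census r₁))
      (count-≤-along {heavy} {light} π λ x → heavy⇒light (regionOf x) (regionOf (π ⟨$⟩ʳ x)) (disjoint x))

  disjoint-permutation : ∀ {k} → #S₁ ≡ k → #S₂ ≡ k → #S₃ ≡ k →
    census r₁₂₃ ≤ census r∅ → #heavy ≤ #light →
    ∃ λ (π : Permutation′ n) → ∀ x → Disjoint (regionOf x) (regionOf (π ⟨$⟩ʳ x))
  disjoint-permutation #S₁≡k #S₂≡k #S₃≡k r₁₂₃≤r∅ #heavy≤#light =
    let π , disjoint = plan⇒permutation n τ τ (plan σ) (plan-disjoint σ) outflow≡
                         (λ u → trans (inflow≡outflow σ u) (outflow≡ u))
    in π , λ x → subst₂ Disjoint (region-index (regionOf x)) (region-index (regionOf (π ⟨$⟩ʳ x))) (disjoint x)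
    where
    τ : Fin n → Fin 8
    τ = index ∘ regionOf
    σ : Schedule
    σ = scheduleFor
    outflow≡ : ∀ t → outflow (plan σ) t ≡ census t
    outflow≡ = outflow-scheduleFor #S₁≡k #S₂≡k #S₃≡k r₁₂₃≤r∅ #heavy≤#light

theorem2p2 : (n k : ℕ) (S₁ S₂ S₃ : Subset n) →
    ∣ S₁ ∣ ≡ k → ∣ S₂ ∣ ≡ k → ∣ S₃ ∣ ≡ k →
    Invertible (lookup (S₁ ∷ S₂ ∷ S₃ ∷ []))
      ⇔ ((∣ S₁ ∩ S₂ ∩ S₃ ∣ ≤ ∣ ∁ S₁ ∩ ∁ S₂ ∩ ∁ S₃ ∣)
         × (2 * ∣ ∁ S₁ ∩ ∁ S₂ ∩ ∁ S₃ ∣ + 6 * k ≤ 2 * ∣ S₁ ∩ S₂ ∩ S₃ ∣ + 3 * n))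
theorem2p2 n k S₁ S₂ S₃ ∣S₁∣≡k ∣S₂∣≡k ∣S₃∣≡k = mk⇔
  (λ invertible → let π , disjoint = to invertible⇔ invertible in
     subst₂ _≤_ (sym ∣S₁∩S₂∩S₃∣≡) (sym ∣∁S₁∩∁S₂∩∁S₃∣≡) (r₁₂₃≤r∅ π disjoint) ,
     from budget⇔ (#heavy≤#light π disjoint))
  (λ (∣full∣≤∣empty∣ , budget) → from invertible⇔ (disjoint-permutation #S₁≡k #S₂≡k #S₃≡k
     (subst₂ _≤_ ∣S₁∩S₂∩S₃∣≡ ∣∁S₁∩∁S₂∩∁S₃∣≡ ∣full∣≤∣empty∣) (to budget⇔ budget)))
  where
  open Venn S₁ S₂ S₃
  open Census census
  open Equivalence
  #S₁≡k : #S₁ ≡ k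
  #S₁≡k = trans (sym ∣S₁∣≡) ∣S₁∣≡k
  #S₂≡k : #S₂ ≡ k
  #S₂≡k = trans (sym ∣S₂∣≡) ∣S₂∣≡k
  #S₃≡k : #S₃ ≡ k
  #S₃≡k = trans (sym ∣S₃∣≡) ∣S₃∣≡k
  budget⇔ : 2 * ∣ ∁ S₁ ∩ ∁ S₂ ∩ ∁ S₃ ∣ + 6 * k ≤ 2 * ∣ S₁ ∩ S₂ ∩ S₃ ∣ + 3 * n ⇔ #heavy ≤ #light
  budget⇔ = budget⇔#heavy≤#light #S₁≡k #S₂≡k #S₃≡k ∣∁S₁∩∁S₂∩∁S₃∣≡ ∣S₁∩S₂∩S₃∣≡ n≡#V
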